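{- Let $k$ be a positive integer that is not a perfect square, and suppose there is a positive integer $d$ such that $\dfrac{4d^2}{k-d^2}$ is a negative integer. Suppose moreover that $(k,d)$ is not of either of the following forms, for a positive integer $s$: (i) $k=5s^2$ and $d\in\{3s,5s\}$ where $2s$ divides some Fibonacci number $F_{2n+1}$ of odd index; (ii) $k=2s^2$ and $d=2s$ where $s$ divides some Pell number $G_{2n+1}$ of odd index. Then the negative Pell equation $p^2-kq^2=-1$ has no solutions in integers $p,q$.
   Context: $F_0=0$, $F_1=1$, $F_{n+1}=F_n+F_{n-1}$; $G_0=0$, $G_1=1$, $G_{n+1}=2G_n+G_{n-1}$. -}

module Defs where

open import Data.Nat using (ℕ; zero; suc; _+_; _*_)

F : ℕ → ℕ
F zero = 0
F (suc zero) = 1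
F (suc (suc n)) = F (suc n) + F n

G : ℕ → ℕ
G zero = 0
G (suc zero) = 1
G (suc (suc n)) = 2 * G (suc n) + G n

{-# OPTIONS --safe #-}
module Submission where

-- A solution of p² − k q² = −1 together with 4d² = −t (k − d²), t > 0, gives the positive
-- solution u = d|q| − |p|, v = 2d|q| of v² + t (u² + 1) = t u v.  The Vieta involutions
-- u ↦ v − u and v ↦ t u − v decrease u + v until 2u ≤ v and 2v ≤ t u; there
-- t u (v − 2u) + v (t u − 2v) = 2t forces (t, u, v) to be (5, 2, 5), (8, 1, 4) or (9, 1, 3).
-- Running the involutions forwards from these gives v = 5 F(2n+1), 4 G(2n+1) or 3 F(2n+1),
-- and t k = (t − 4) d² together with v = 2d|q| puts (k, d) into an excluded family.

open import Defs
open import Data.Nat using (ℕ; _*_; _+_; _<_)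
open import Data.Nat.Divisibility using (_∣_)
open import Data.Integer as ℤ using (ℤ; +_)
open import Data.Product using (Σ; ∃; _×_; _,_)
open import Data.Sum using (_⊎_)
open import Relation.Nullary using (¬_)
open import Relation.Binary.PropositionalEquality using (_≡_)

open import Data.Nat using (suc; zero; _≤_; _∸_; z≤n; s≤s; z<s; _<?_; NonZero; >-nonZero)
open import Data.Nat.Properties
open import Data.Nat.Divisibility using (divides; m∣m*n; _∣?_)
open import Data.Nat.Primality using (Prime; prime?; euclidsLemma; prime[2]; prime⇒nonZero)
open import Data.Nat.Tactic.RingSolver using (solve; solve-∀)
open import Data.List using (_∷_; [])
open import Data.Product using (proj₁; ∃-syntax)
open import Data.Sum using (inj₁; inj₂; [_,_]′; reduce)
open import Data.Empty using (⊥-elim)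
open import Relation.Nullary using (yes; no)
open import Relation.Nullary.Decidable using (from-yes; from-no)
open import Relation.Binary.PropositionalEquality
  using (_≢_; refl; sym; trans; cong; cong₂; subst; subst₂; module ≡-Reasoning)
import Data.Integer.Properties as ℤ
import Data.Integer.Tactic.RingSolver as ℤ

+-cancel-cross : ∀ {a b c d} → a + b ≡ c + d → a ≡ d → b ≡ c
+-cancel-cross {a} {b} {c} e refl = +-cancelˡ-≡ a b c (trans e (+-comm c a))

record Solves (t u v : ℕ) : Set where
  constructor solves
  field equation : v * v + t * (u * u + 1) ≡ t * (u * v)

solves-flipᵘ : ∀ {t u u' v} → u + u' ≡ v → Solves t u v → Solves t u' v
solves-flipᵘ {t} {u} {u'} refl (solves s) = solves (sym (+-cancel-cross vieta s))
  where
  vieta : (u + u') * (u + u') + t * (u * u + 1) + t * (u' * (u + u'))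
        ≡ (u + u') * (u + u') + t * (u' * u' + 1) + t * (u * (u + u'))
  vieta = solve (t ∷ u ∷ u' ∷ [])

solves-flipᵛ : ∀ {t u v v'} → v + v' ≡ t * u → Solves t u v → Solves t u v'
solves-flipᵛ {t} {u} {v} {v'} e (solves s) = solves (sym (+-cancel-cross vieta s))
  where
  open ≡-Reasoning
  c = t * (u * u + 1)
  vieta : v * v + t * (u * u + 1) + t * (u * v') ≡ v' * v' + t * (u * u + 1) + t * (u * v)
  vieta = begin
    v * v + c + t * (u * v')    ≡⟨ cong (λ w → v * v + c + w) (sym (*-assoc t u v')) ⟩
    v * v + c + t * u * v'      ≡⟨ cong (λ w → v * v + c + w * v') (sym e) ⟩
    v * v + c + (v + v') * v'   ≡⟨ square-swap c v v' ⟩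
    v' * v' + c + (v + v') * v  ≡⟨ cong (λ w → v' * v' + c + w * v) e ⟩
    v' * v' + c + t * u * v     ≡⟨ cong (λ w → v' * v' + c + w) (*-assoc t u v) ⟩
    v' * v' + c + t * (u * v)   ∎
    where
    square-swap : ∀ c x y → x * x + c + (x + y) * y ≡ y * y + c + (x + y) * x
    square-swap = solve-∀

solves⇒u<v : ∀ {t u v} → 0 < t → Solves t u v → u < v
solves⇒u<v {t} {u} {v} t>0 (solves s) = ≰⇒> λ v≤u → <-irrefl (sym s) (begin-strict
  t * (u * v)                ≤⟨ *-monoʳ-≤ t (*-monoʳ-≤ u v≤u) ⟩
  t * (u * u)                <⟨ *-monoʳ-< t (m<m+n (u * u) z<s) ⟩
  t * (u * u + 1)            ≤⟨ m≤n+m _ (v * v) ⟩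
  v * v + t * (u * u + 1)    ∎)
  where
  open ≤-Reasoning
  instance _ = >-nonZero t>0

solves⇒v<t*u : ∀ {t u v} → 0 < t → Solves t u v → v < t * u
solves⇒v<t*u {t} {u} {v} t>0 (solves s) = ≰⇒> λ tu≤v → <-irrefl (sym s) (begin-strict
  t * (u * v)                ≡⟨ *-assoc t u v ⟨
  t * u * v                  ≤⟨ *-monoˡ-≤ v tu≤v ⟩
  v * v                      <⟨ m<m+n (v * v) (*-mono-≤ t>0 (m≤n+m 1 (u * u))) ⟩
  v * v + t * (u * u + 1)    ∎)
  where open ≤-Reasoning

fibOdd fibEven : ℕ → ℕ
fibOdd zero = 1
fibOdd (suc n) = 2 * fibOdd n + fibEven n
fibEven zero = 0
fibEven (suc n) = fibOdd n + fibEven n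

pellOdd pellEven : ℕ → ℕ
pellOdd zero = 1
pellOdd (suc n) = 5 * pellOdd n + 2 * pellEven n
pellEven zero = 0
pellEven (suc n) = 2 * pellOdd n + pellEven n

F-odd-even : ∀ n → F (suc (2 * n)) ≡ fibOdd n × F (2 * n) ≡ fibEven n
F-odd-even zero = refl , refl
F-odd-even (suc n) with F-odd-even n
... | odd , even = subst (λ m → F (suc m) ≡ fibOdd (suc n) × F m ≡ fibEven (suc n)) (sym (*-suc 2 n))
  ( trans (cong₂ (λ a b → a + b + a) odd even) (step (fibOdd n) (fibEven n))
  , cong₂ _+_ odd even)
  where
  step : ∀ a b → a + b + a ≡ 2 * a + b
  step = solve-∀

G-odd-even : ∀ n → G (suc (2 * n)) ≡ pellOdd n × G (2 * n) ≡ pellEven n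
G-odd-even zero = refl , refl
G-odd-even (suc n) with G-odd-even n
... | odd , even = subst (λ m → G (suc m) ≡ pellOdd (suc n) × G m ≡ pellEven (suc n)) (sym (*-suc 2 n))
  ( trans (cong₂ (λ a b → 2 * (2 * a + b) + a) odd even) (step (pellOdd n) (pellEven n))
  , cong₂ (λ a b → 2 * a + b) odd even)
  where
  step : ∀ a b → 2 * (2 * a + b) + a ≡ 5 * a + 2 * b
  step = solve-∀

F-odd : ∀ n → F (2 * n + 1) ≡ fibOdd n
F-odd n = trans (cong F (+-comm (2 * n) 1)) (proj₁ (F-odd-even n))

G-odd : ∀ n → G (2 * n + 1) ≡ pellOdd n
G-odd n = trans (cong G (+-comm (2 * n) 1)) (proj₁ (G-odd-even n))

-- u is one of α a − b and β a + b, written without truncated subtraction.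
TwoForms : ℕ → ℕ → ℕ → ℕ → ℕ → Set
TwoForms α β a b u = u + b ≡ α * a ⊎ u ≡ β * a + b

twoForms-flip : ∀ α β a b {u u'} → u + u' ≡ (α + β) * a → TwoForms α β a b u' → TwoForms α β a b u
twoForms-flip α β a b {u} {u'} e (inj₁ u'+b≡αa) = inj₂ (+-cancelʳ-≡ (α * a) u (β * a + b) (begin
  u + α * a           ≡⟨ cong (_+_ u) u'+b≡αa ⟨
  u + (u' + b)        ≡⟨ +-assoc u u' b ⟨
  u + u' + b          ≡⟨ cong (_+ b) e ⟩
  (α + β) * a + b     ≡⟨ solve (α ∷ β ∷ a ∷ b ∷ []) ⟩
  β * a + b + α * a   ∎))
  where open ≡-Reasoning
twoForms-flip α β a b {u} e (inj₂ refl) = inj₁ (+-cancelʳ-≡ (β * a) (u + b) (α * a) (begin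
  u + b + β * a       ≡⟨ solve (u ∷ b ∷ β ∷ a ∷ []) ⟩
  u + (β * a + b)     ≡⟨ e ⟩
  (α + β) * a         ≡⟨ *-distribʳ-+ a α β ⟩
  α * a + β * a       ∎))
  where open ≡-Reasoning

data Orbit (α β : ℕ) (a b : ℕ → ℕ) (u v : ℕ) : Set where
  orbit : ∀ n → v ≡ (α + β) * a n → TwoForms α β (a n) (b n) u → Orbit α β a b u v

orbit-flipᵘ : ∀ {α β a b u u' v} → u + u' ≡ v → Orbit α β a b u' v → Orbit α β a b u v
orbit-flipᵘ {α} {β} {a} {b} e (orbit n refl forms) = orbit n refl (twoForms-flip α β (a n) (b n) e forms)

orbit₅-flipᵛ : ∀ {u v v'} → v + v' ≡ 5 * u → Orbit 2 3 fibOdd fibEven u v' → Orbit 2 3 fibOdd fibEven u v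
orbit₅-flipᵛ {v = v} e (orbit n refl (inj₂ refl)) =
  orbit (suc n) (+-cancelʳ-≡ _ v _ (trans e (jump a b))) (inj₁ (form a b))
  where
  a = fibOdd n
  b = fibEven n
  jump : ∀ a b → 5 * (3 * a + b) ≡ 5 * (2 * a + b) + 5 * a
  jump = solve-∀
  form : ∀ a b → 3 * a + b + (a + b) ≡ 2 * (2 * a + b)
  form = solve-∀
orbit₅-flipᵛ {u} {v} e (orbit zero refl (inj₁ u+0≡2)) with trans (sym (+-identityʳ u)) u+0≡2
... | refl = orbit zero (+-cancelʳ-≡ 5 v 5 e) (inj₁ refl)
orbit₅-flipᵛ {u} e (orbit (suc n) refl (inj₁ u+b≡2a)) =
  descend e (+-cancelʳ-≡ _ u _ (trans u+b≡2a (form a b)))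
  where
  a = fibOdd n
  b = fibEven n
  form : ∀ a b → 2 * (2 * a + b) ≡ 3 * a + b + (a + b)
  form = solve-∀
  jump : ∀ a b → 5 * (3 * a + b) ≡ 5 * a + 5 * (2 * a + b)
  jump = solve-∀
  descend : ∀ {u v} → v + 5 * fibOdd (suc n) ≡ 5 * u → u ≡ 3 * a + b → Orbit 2 3 fibOdd fibEven u v
  descend {v = v} e refl = orbit n (+-cancelʳ-≡ _ v _ (trans e (jump a b))) (inj₂ refl)

orbit₉-flipᵛ : ∀ {u v v'} → v + v' ≡ 9 * u → Orbit 1 2 fibOdd fibEven u v' → Orbit 1 2 fibOdd fibEven u v
orbit₉-flipᵛ {v = v} e (orbit n refl (inj₂ refl)) =
  orbit (suc (suc n)) (+-cancelʳ-≡ _ v _ (trans e (jump a b))) (inj₁ (form a b))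
  where
  a = fibOdd n
  b = fibEven n
  jump : ∀ a b → 9 * (2 * a + b) ≡ 3 * (2 * (2 * a + b) + (a + b)) + 3 * a
  jump = solve-∀
  form : ∀ a b → 2 * a + b + (2 * a + b + (a + b)) ≡ 1 * (2 * (2 * a + b) + (a + b))
  form = solve-∀
orbit₉-flipᵛ {u} {v} e (orbit zero refl (inj₁ u+0≡1)) with trans (sym (+-identityʳ u)) u+0≡1
... | refl = orbit 1 (+-cancelʳ-≡ 3 v 6 e) (inj₁ refl)
orbit₉-flipᵛ {u} {v} e (orbit (suc zero) refl (inj₁ u+1≡2)) with +-cancelʳ-≡ 1 u 1 u+1≡2
... | refl = orbit 0 (+-cancelʳ-≡ 6 v 3 e) (inj₁ refl)
orbit₉-flipᵛ {u} e (orbit (suc (suc n)) refl (inj₁ u+b≡a)) =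
  descend e (+-cancelʳ-≡ _ u _ (trans u+b≡a (form a b)))
  where
  a = fibOdd n
  b = fibEven n
  form : ∀ a b → 1 * (2 * (2 * a + b) + (a + b)) ≡ 2 * a + b + (2 * a + b + (a + b))
  form = solve-∀
  jump : ∀ a b → 9 * (2 * a + b) ≡ 3 * a + 3 * (2 * (2 * a + b) + (a + b))
  jump = solve-∀
  descend : ∀ {u v} → v + 3 * fibOdd (suc (suc n)) ≡ 9 * u → u ≡ 2 * a + b → Orbit 1 2 fibOdd fibEven u v
  descend {v = v} e refl = orbit n (+-cancelʳ-≡ _ v _ (trans e (jump a b))) (inj₂ refl)

orbit₈-flipᵛ : ∀ {u v v'} → v + v' ≡ 8 * u → Orbit 1 3 pellOdd pellEven u v' → Orbit 1 3 pellOdd pellEven u v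
orbit₈-flipᵛ {v = v} e (orbit n refl (inj₂ refl)) =
  orbit (suc n) (+-cancelʳ-≡ _ v _ (trans e (jump g h))) (inj₁ (form g h))
  where
  g = pellOdd n
  h = pellEven n
  jump : ∀ g h → 8 * (3 * g + h) ≡ 4 * (5 * g + 2 * h) + 4 * g
  jump = solve-∀
  form : ∀ g h → 3 * g + h + (2 * g + h) ≡ 1 * (5 * g + 2 * h)
  form = solve-∀
orbit₈-flipᵛ {u} {v} e (orbit zero refl (inj₁ u+0≡1)) with trans (sym (+-identityʳ u)) u+0≡1
... | refl = orbit zero (+-cancelʳ-≡ 4 v 4 e) (inj₁ refl)
orbit₈-flipᵛ {u} e (orbit (suc n) refl (inj₁ u+h≡g)) =
  descend e (+-cancelʳ-≡ _ u _ (trans u+h≡g (form g h)))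
  where
  g = pellOdd n
  h = pellEven n
  form : ∀ g h → 1 * (5 * g + 2 * h) ≡ 3 * g + h + (2 * g + h)
  form = solve-∀
  jump : ∀ g h → 8 * (3 * g + h) ≡ 4 * g + 4 * (5 * g + 2 * h)
  jump = solve-∀
  descend : ∀ {u v} → v + 4 * pellOdd (suc n) ≡ 8 * u → u ≡ 3 * g + h → Orbit 1 3 pellOdd pellEven u v
  descend {v = v} e refl = orbit n (+-cancelʳ-≡ _ v _ (trans e (jump g h))) (inj₂ refl)

-- The orbits of the solutions (t, u, v) = (5, 2, 5), (8, 1, 4), (9, 1, 3) under the two involutions.
data Exceptional : ℕ → ℕ → ℕ → Set where
  t≡5 : ∀ {u v} → Orbit 2 3 fibOdd fibEven u v → Exceptional 5 u v
  t≡8 : ∀ {u v} → Orbit 1 3 pellOdd pellEven u v → Exceptional 8 u v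
  t≡9 : ∀ {u v} → Orbit 1 2 fibOdd fibEven u v → Exceptional 9 u v

exceptional-flipᵘ : ∀ {t u u' v} → u + u' ≡ v → Exceptional t u' v → Exceptional t u v
exceptional-flipᵘ e (t≡5 o) = t≡5 (orbit-flipᵘ e o)
exceptional-flipᵘ e (t≡8 o) = t≡8 (orbit-flipᵘ e o)
exceptional-flipᵘ e (t≡9 o) = t≡9 (orbit-flipᵘ e o)

exceptional-flipᵛ : ∀ {t u v v'} → v + v' ≡ t * u → Exceptional t u v' → Exceptional t u v
exceptional-flipᵛ e (t≡5 o) = t≡5 (orbit₅-flipᵛ e o)
exceptional-flipᵛ e (t≡8 o) = t≡8 (orbit₈-flipᵛ e o)
exceptional-flipᵛ e (t≡9 o) = t≡9 (orbit₉-flipᵛ e o)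

c*m+t*n≡t*[c+n]⇒t≡m : ∀ c m n {t} .{{_ : NonZero c}} → c * m + t * n ≡ t * (c + n) → t ≡ m
c*m+t*n≡t*[c+n]⇒t≡m c m n {t} e = sym (*-cancelˡ-≡ m t c (+-cancelʳ-≡ (t * n) (c * m) (c * t) (begin
  c * m + t * n    ≡⟨ e ⟩
  t * (c + n)      ≡⟨ *-distribˡ-+ t c n ⟩
  t * c + t * n    ≡⟨ cong (_+ t * n) (*-comm t c) ⟩
  c * t + t * n    ∎)))
  where open ≡-Reasoning

-- With t = 5 + s, t u² − 4u² − t is −t, −4 and 3s − 1 for u = 0, 1, 2, and positive for u ≥ 3.
4u²+t≢tu² : ∀ s u → 4 * (u * u) + (5 + s) ≢ (5 + s) * (u * u)
4u²+t≢tu² s zero e with trans e (*-zeroʳ (5 + s))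
... | ()
4u²+t≢tu² s 1 e = m≢1+n+m (5 + s) {n = 3} (sym (trans e (*-identityʳ (5 + s))))
4u²+t≢tu² zero 2 ()
4u²+t≢tu² (suc s) 2 e = m+1+n≢m _ (sym (trans e (excess s)))
  where
  excess : ∀ s → (6 + s) * 4 ≡ 16 + (6 + s) + (2 + 3 * s)
  excess = solve-∀
4u²+t≢tu² s (suc (suc (suc w))) e = m+1+n≢m _ (sym (trans e (excess s w)))
  where
  excess : ∀ s w → (5 + s) * ((3 + w) * (3 + w))
         ≡ 4 * ((3 + w) * (3 + w)) + (5 + s) + (4 + (6 * w + w * w + 8 * s + s * (6 * w + w * w)))
  excess = solve-∀

¬solves-v≡2u : ∀ {t u} → 5 ≤ t → ¬ Solves t u (2 * u)
¬solves-v≡2u {u = u} (s≤s (s≤s (s≤s (s≤s (s≤s {n = s} _))))) (solves sol) =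
  4u²+t≢tu² s u (+-cancelʳ-≡ _ _ _ (trans (expand (5 + s) u) (trans sol (double (5 + s) u))))
  where
  expand : ∀ t u → 4 * (u * u) + t + t * (u * u) ≡ 2 * u * (2 * u) + t * (u * u + 1)
  expand = solve-∀
  double : ∀ t u → t * (u * (2 * u)) ≡ t * (u * u) + t * (u * u)
  double = solve-∀

reduced-solution : ∀ {t u x} → 5 ≤ t → 1 ≤ u → u * x ≤ 2
  → Solves t u (2 * u + x) → Exceptional t u (2 * u + x)
reduced-solution {u = zero} _ () _ _
reduced-solution {u = suc u} {x = zero} 5≤t _ _ s =
  ⊥-elim (¬solves-v≡2u 5≤t (subst (Solves _ (suc u)) (+-identityʳ (2 * suc u)) s))
reduced-solution {t} {u = 1} {x = 1} _ _ _ s with c*m+t*n≡t*[c+n]⇒t≡m 1 9 2 {t} (Solves.equation s)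
... | refl = t≡9 (orbit 0 refl (inj₁ refl))
reduced-solution {t} {u = 1} {x = 2} _ _ _ s with c*m+t*n≡t*[c+n]⇒t≡m 2 8 2 {t} (Solves.equation s)
... | refl = t≡8 (orbit 0 refl (inj₁ refl))
reduced-solution {t} {u = 2} {x = 1} _ _ _ s with c*m+t*n≡t*[c+n]⇒t≡m 5 5 5 {t} (Solves.equation s)
... | refl = t≡5 (orbit 0 refl (inj₁ refl))
reduced-solution {u = 1} {x = suc (suc (suc _))} _ _ (s≤s (s≤s ())) _
reduced-solution {u = 2} {x = suc (suc x)} _ _ ux≤2 _
  with ≤-trans (*-monoʳ-≤ 2 (s≤s (s≤s (z≤n {x})))) ux≤2
... | s≤s (s≤s ())
reduced-solution {u = suc (suc (suc u))} {x = suc x} _ _ ux≤2 _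
  with ≤-trans (m≤m*n (3 + u) (suc x)) ux≤2
... | s≤s (s≤s ())

reduced-identity : ∀ {t u v x y} → 2 * u + x ≡ v → 2 * v + y ≡ t * u → Solves t u v
  → t * (u * x) + v * y ≡ t * 2
reduced-identity {t} {u} {v} {x} {y} ex ey (solves s) = +-cancelʳ-≡ (2 * (t * (u * v))) _ _ (begin
  t * (u * x) + v * y + 2 * (t * (u * v))              ≡⟨ cong (λ w → t * (u * x) + v * y + 2 * w) s ⟨
  t * (u * x) + v * y + 2 * (v * v + t * (u * u + 1))  ≡⟨ solve (t ∷ u ∷ v ∷ x ∷ y ∷ []) ⟩
  t * 2 + t * (u * (2 * u + x)) + v * (2 * v + y)      ≡⟨ cong₂ (λ w z → t * 2 + t * (u * w) + v * z) ex ey ⟩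
  t * 2 + t * (u * v) + v * (t * u)                    ≡⟨ solve (t ∷ u ∷ v ∷ []) ⟩
  t * 2 + 2 * (t * (u * v))                            ∎)
  where open ≡-Reasoning

fundamental : ∀ {t u v} → 5 ≤ t → 1 ≤ u → 2 * u ≤ v → 2 * v ≤ t * u → Solves t u v → Exceptional t u v
fundamental {t} {u} {v} 5≤t 1≤u 2u≤v 2v≤tu s =
  subst (Exceptional t u) ex (reduced-solution 5≤t 1≤u ux≤2 (subst (Solves t u) (sym ex) s))
  where
  instance _ = >-nonZero (≤-trans z<s 5≤t)
  ex : 2 * u + (v ∸ 2 * u) ≡ v
  ex = m+[n∸m]≡n 2u≤v
  ux≤2 : u * (v ∸ 2 * u) ≤ 2
  ux≤2 = *-cancelˡ-≤ t (≤-trans (m≤m+n _ _) (≤-reflexive (reduced-identity ex (m+[n∸m]≡n 2v≤tu) s)))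

classify-bounded : ∀ N {t u v} → u + v ≤ N → 5 ≤ t → 1 ≤ u → Solves t u v → Exceptional t u v
classify-bounded zero {u = suc _} () _ _ _
classify-bounded (suc N) {t} {u} {v} bound 5≤t 1≤u s with v <? 2 * u | t * u <? 2 * v
... | yes v<2u | _ =
  exceptional-flipᵘ jump (classify-bounded N bound′ 5≤t (m<n⇒0<n∸m u<v) (solves-flipᵘ jump s))
  where
  u<v = solves⇒u<v (≤-trans z<s 5≤t) s
  jump : u + (v ∸ u) ≡ v
  jump = m+[n∸m]≡n (<⇒≤ u<v)
  smaller : v ∸ u < u
  smaller = +-cancelˡ-< u (v ∸ u) u (subst₂ _<_ (sym jump) (cong (_+_ u) (+-identityʳ u)) v<2u)
  bound′ : v ∸ u + v ≤ N
  bound′ = ≤-pred (≤-trans (+-monoˡ-< v smaller) bound)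
... | no _ | yes tu<2v =
  exceptional-flipᵛ jump (classify-bounded N bound′ 5≤t 1≤u (solves-flipᵛ jump s))
  where
  v<tu = solves⇒v<t*u (≤-trans z<s 5≤t) s
  jump : v + (t * u ∸ v) ≡ t * u
  jump = m+[n∸m]≡n (<⇒≤ v<tu)
  smaller : t * u ∸ v < v
  smaller = +-cancelˡ-< v (t * u ∸ v) v (subst₂ _<_ (sym jump) (cong (_+_ v) (+-identityʳ v)) tu<2v)
  bound′ : u + (t * u ∸ v) ≤ N
  bound′ = ≤-pred (≤-trans (+-monoʳ-< u smaller) bound)
... | no v≮2u | no tu≮2v = fundamental 5≤t 1≤u (≮⇒≥ v≮2u) (≮⇒≥ tu≮2v) s

classify : ∀ {t u v} → 5 ≤ t → 1 ≤ u → Solves t u v → Exceptional t u v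
classify = classify-bounded _ ≤-refl

FibonacciException PellException : ℕ → ℕ → Set
FibonacciException k d =
  Σ ℕ λ s → (0 < s) × (k ≡ 5 * (s * s)) × ((d ≡ 3 * s) ⊎ (d ≡ 5 * s)) × (Σ ℕ λ n → (2 * s) ∣ F (2 * n + 1))
PellException k d =
  Σ ℕ λ s → (0 < s) × (k ≡ 2 * (s * s)) × (d ≡ 2 * s) × (Σ ℕ λ n → s ∣ G (2 * n + 1))

0<m*n⇒0<m : ∀ {m n} → 0 < m * n → 0 < m
0<m*n⇒0<m {suc _} _ = z<s

∣-cancel : ∀ c m q {a} .{{_ : NonZero c}} → c * (m * q) ≡ c * a → m ∣ a
∣-cancel c m q {a} e = subst (m ∣_) (*-cancelˡ-≡ (m * q) a c e) (m∣m*n q)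

2*[s*p*q]≡p*a⇒2*s∣a : ∀ p s q {a} .{{_ : NonZero p}} → 2 * (s * p * q) ≡ p * a → 2 * s ∣ a
2*[s*p*q]≡p*a⇒2*s∣a p s q e = ∣-cancel p (2 * s) q (trans (regroup p s q) e)
  where
  regroup : ∀ p s q → p * (2 * s * q) ≡ 2 * (s * p * q)
  regroup = solve-∀

2*[s*2*q]≡4*a⇒s∣a : ∀ s q {a} → 2 * (s * 2 * q) ≡ 4 * a → s ∣ a
2*[s*2*q]≡4*a⇒s∣a s q e = ∣-cancel 4 s q (trans (regroup s q) e)
  where
  regroup : ∀ s q → 4 * (s * q) ≡ 2 * (s * 2 * q)
  regroup = solve-∀

prime-square-root : ∀ {p c m d} → Prime p → ¬ p ∣ c → p * m ≡ c * (d * d)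
  → ∃[ s ] d ≡ s * p × m ≡ c * p * (s * s)
prime-square-root {p} {c} {m} {d} pp p∤c e
  with euclidsLemma c (d * d) pp (divides m (trans (sym e) (*-comm p m)))
... | inj₁ p∣c = ⊥-elim (p∤c p∣c)
... | inj₂ p∣dd with reduce (euclidsLemma d d pp p∣dd)
...   | divides s refl =
  s , refl , *-cancelˡ-≡ m (c * p * (s * s)) p {{prime⇒nonZero pp}} (trans e (solve (c ∷ s ∷ p ∷ [])))

relation⇒tk≡[t-4]d² : ∀ r k d → 4 * (d * d) + (4 + r) * k ≡ (4 + r) * (d * d)
  → (4 + r) * k ≡ r * (d * d)
relation⇒tk≡[t-4]d² r k d rel = +-cancelˡ-≡ (4 * (d * d)) _ _ (trans rel (*-distribʳ-+ (d * d) 4 r))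

exception₅ : ∀ {k d Q n} → 0 < d → 4 * (d * d) + 5 * k ≡ 5 * (d * d) → 2 * (d * Q) ≡ 5 * fibOdd n
  → FibonacciException k d
exception₅ {k} {d} {Q} {n} d>0 rel v≡
  with prime-square-root {m = k} {d} (from-yes (prime? 5)) (from-no (5 ∣? 1)) (relation⇒tk≡[t-4]d² 1 k d rel)
... | s , refl , refl = s , 0<m*n⇒0<m d>0 , solve (s ∷ []) , inj₂ (*-comm s 5) , n ,
  subst (2 * s ∣_) (sym (F-odd n)) (2*[s*p*q]≡p*a⇒2*s∣a 5 s Q v≡)

exception₉ : ∀ {k d Q n} → 0 < d → 4 * (d * d) + 9 * k ≡ 9 * (d * d) → 2 * (d * Q) ≡ 3 * fibOdd n
  → FibonacciException k d
exception₉ {k} {d} {Q} {n} d>0 rel v≡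
  with prime-square-root {m = 3 * k} {d} (from-yes (prime? 3)) (from-no (3 ∣? 5))
         (trans (sym (*-assoc 3 3 k)) (relation⇒tk≡[t-4]d² 5 k d rel))
... | s , refl , 3k≡15s² =
  s , 0<m*n⇒0<m d>0 , *-cancelˡ-≡ k (5 * (s * s)) 3 (trans 3k≡15s² (solve (s ∷ []))) , inj₁ (*-comm s 3) , n ,
  subst (2 * s ∣_) (sym (F-odd n)) (2*[s*p*q]≡p*a⇒2*s∣a 3 s Q v≡)

exception₈ : ∀ {k d Q n} → 0 < d → 4 * (d * d) + 8 * k ≡ 8 * (d * d) → 2 * (d * Q) ≡ 4 * pellOdd n
  → PellException k d
exception₈ {k} {d} {Q} {n} d>0 rel v≡ with prime-square-root {m = k} {d} prime[2] (from-no (2 ∣? 1)) 2k≡d²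
  where
  2k≡d² : 2 * k ≡ 1 * (d * d)
  2k≡d² = *-cancelˡ-≡ (2 * k) (1 * (d * d)) 4
    (trans (sym (*-assoc 4 2 k)) (trans (relation⇒tk≡[t-4]d² 4 k d rel) (cong (4 *_) (sym (*-identityˡ (d * d))))))
... | s , refl , refl = s , 0<m*n⇒0<m d>0 , solve (s ∷ []) , *-comm s 2 , n ,
  subst (s ∣_) (sym (G-odd n)) (2*[s*2*q]≡4*a⇒s∣a s Q v≡)

exceptional⇒exception : ∀ {t u k d Q} → 0 < d → 4 * (d * d) + t * k ≡ t * (d * d)
  → Exceptional t u (2 * (d * Q)) → FibonacciException k d ⊎ PellException k d
exceptional⇒exception {k = k} {d} {Q} d>0 rel (t≡5 (orbit n v≡ _)) = inj₁ (exception₅ {k} {d} {Q} {n} d>0 rel v≡)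
exceptional⇒exception {k = k} {d} {Q} d>0 rel (t≡8 (orbit n v≡ _)) = inj₂ (exception₈ {k} {d} {Q} {n} d>0 rel v≡)
exceptional⇒exception {k = k} {d} {Q} d>0 rel (t≡9 (orbit n v≡ _)) = inj₁ (exception₉ {k} {d} {Q} {n} d>0 rel v≡)

relation⇒5≤t : ∀ {t k d} → 0 < t → 0 < k → 4 * (d * d) + t * k ≡ t * (d * d) → 5 ≤ t
relation⇒5≤t {t} {k} {d} t>0 k>0 rel = *-cancelʳ-< (d * d) 4 t (begin-strict
  4 * (d * d)          <⟨ m<m+n (4 * (d * d)) (*-mono-≤ t>0 k>0) ⟩
  4 * (d * d) + t * k  ≡⟨ rel ⟩
  t * (d * d)          ∎)
  where open ≤-Reasoning

pell-scaled : ∀ {t k d P Q} → 4 * (d * d) + t * k ≡ t * (d * d) → P * P + 1 ≡ k * (Q * Q)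
  → t * (P * P + 1) + 4 * (d * Q * (d * Q)) ≡ t * (d * Q * (d * Q))
pell-scaled {t} {k} {d} {P} {Q} rel pell = begin
  t * (P * P + 1) + 4 * (d * Q * (d * Q))    ≡⟨ cong (λ w → t * w + 4 * (d * Q * (d * Q))) pell ⟩
  t * (k * (Q * Q)) + 4 * (d * Q * (d * Q))  ≡⟨ solve (t ∷ k ∷ d ∷ Q ∷ []) ⟩
  (4 * (d * d) + t * k) * (Q * Q)            ≡⟨ cong (_* (Q * Q)) rel ⟩
  t * (d * d) * (Q * Q)                      ≡⟨ solve (t ∷ d ∷ Q ∷ []) ⟩
  t * (d * Q * (d * Q))                      ∎
  where open ≡-Reasoning

scaled-pell⇒P<D : ∀ {t P D} → 0 < t → t * (P * P + 1) + 4 * (D * D) ≡ t * (D * D) → P < D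
scaled-pell⇒P<D {t} {P} {D} t>0 h = ≰⇒> λ D≤P → <⇒≱ P²<D² (*-mono-≤ D≤P D≤P)
  where
  instance _ = >-nonZero t>0
  P²<D² : P * P < D * D
  P²<D² = subst (_≤ D * D) (+-comm (P * P) 1) (*-cancelˡ-≤ t (≤-trans (m≤m+n _ _) (≤-reflexive h)))

scaled-pell⇒solves : ∀ {t P u D} → P + u ≡ D → t * (P * P + 1) + 4 * (D * D) ≡ t * (D * D)
  → Solves t u (2 * D)
scaled-pell⇒solves {t} {P} {u} {D} P+u≡D h = solves (+-cancelʳ-≡ (t * (P * P)) _ _ (begin
  2 * D * (2 * D) + t * (u * u + 1) + t * (P * P)    ≡⟨ solve (t ∷ P ∷ u ∷ D ∷ []) ⟩
  t * (P * P + 1) + 4 * (D * D) + t * (u * u)        ≡⟨ cong (_+ t * (u * u)) h ⟩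
  t * (D * D) + t * (u * u)                          ≡⟨ cong (λ w → t * (w * w) + t * (u * u)) P+u≡D ⟨
  t * ((P + u) * (P + u)) + t * (u * u)              ≡⟨ solve (t ∷ P ∷ u ∷ []) ⟩
  t * (u * (2 * (P + u))) + t * (P * P)              ≡⟨ cong (λ w → t * (u * (2 * w)) + t * (P * P)) P+u≡D ⟩
  t * (u * (2 * D)) + t * (P * P)                    ∎))
  where open ≡-Reasoning

negative-pell⇒exception : ∀ {k d} t P Q → 0 < k → 0 < d → 0 < t → 4 * (d * d) + t * k ≡ t * (d * d)
  → P * P + 1 ≡ k * (Q * Q) → FibonacciException k d ⊎ PellException k d
negative-pell⇒exception {k} {d} t P Q k>0 d>0 t>0 rel pell =
  exceptional⇒exception {Q = Q} d>0 rel
    (classify (relation⇒5≤t {t} {k} {d} t>0 k>0 rel) (m<n⇒0<n∸m P<D) (scaled-pell⇒solves {t} {P} split scaled))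
  where
  D = d * Q
  scaled : t * (P * P + 1) + 4 * (D * D) ≡ t * (D * D)
  scaled = pell-scaled {t} {k} {d} {P} {Q} rel pell
  P<D : P < D
  P<D = scaled-pell⇒P<D {t} t>0 scaled
  split : P + (D ∸ P) ≡ D
  split = m+[n∸m]≡n (<⇒≤ P<D)

i*i≡+∣i∣*∣i∣ : ∀ i → i ℤ.* i ≡ + (ℤ.∣ i ∣ * ℤ.∣ i ∣)
i*i≡+∣i∣*∣i∣ (+ n) = sym (ℤ.pos-* n n)
i*i≡+∣i∣*∣i∣ ℤ.-[1+ n ] = refl

pell-ℤ⇒ℕ : ∀ k p q → p ℤ.* p ℤ.- (+ k) ℤ.* q ℤ.* q ≡ ℤ.- (+ 1)
  → ℤ.∣ p ∣ * ℤ.∣ p ∣ + 1 ≡ k * (ℤ.∣ q ∣ * ℤ.∣ q ∣)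
pell-ℤ⇒ℕ k p q eq = ℤ.+-injective (begin
  + (P * P + 1)                                      ≡⟨ ℤ.pos-+ (P * P) 1 ⟩
  + (P * P) ℤ.+ + 1                                  ≡⟨ cong (ℤ._+ + 1) (i*i≡+∣i∣*∣i∣ p) ⟨
  p ℤ.* p ℤ.- ℤ.- (+ 1)                              ≡⟨ cong (ℤ._-_ (p ℤ.* p)) eq ⟨
  p ℤ.* p ℤ.- (p ℤ.* p ℤ.- (+ k) ℤ.* q ℤ.* q)        ≡⟨ a-[a-b]≡b (p ℤ.* p) ((+ k) ℤ.* q ℤ.* q) ⟩
  (+ k) ℤ.* q ℤ.* q                                  ≡⟨ ℤ.*-assoc (+ k) q q ⟩
  (+ k) ℤ.* (q ℤ.* q)                                ≡⟨ cong (+ k ℤ.*_) (i*i≡+∣i∣*∣i∣ q) ⟩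
  (+ k) ℤ.* + (Q * Q)                                ≡⟨ ℤ.pos-* k (Q * Q) ⟨
  + (k * (Q * Q))                                    ∎)
  where
  open ≡-Reasoning
  P = ℤ.∣ p ∣
  Q = ℤ.∣ q ∣
  a-[a-b]≡b : ∀ a b → a ℤ.- (a ℤ.- b) ≡ b
  a-[a-b]≡b = ℤ.solve-∀

relation-ℤ⇒ℕ : ∀ k d t → (+ 4) ℤ.* (+ d) ℤ.* (+ d) ≡ ℤ.-[1+ t ] ℤ.* ((+ k) ℤ.- (+ d) ℤ.* (+ d))
  → 4 * (d * d) + suc t * k ≡ suc t * (d * d)
relation-ℤ⇒ℕ k d t eq = ℤ.+-injective (begin
  + (4 * (d * d) + T * k)                                       ≡⟨ ℤ.pos-+ (4 * (d * d)) (T * k) ⟩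
  + (4 * (d * d)) ℤ.+ + (T * k)                                 ≡⟨ cong₂ ℤ._+_ four-d² (ℤ.pos-* T k) ⟩
  (+ 4) ℤ.* (+ d) ℤ.* (+ d) ℤ.+ (+ T) ℤ.* (+ k)                 ≡⟨ cong (ℤ._+ (+ T) ℤ.* (+ k)) eq ⟩
  ℤ.- (+ T) ℤ.* ((+ k) ℤ.- (+ d) ℤ.* (+ d)) ℤ.+ (+ T) ℤ.* (+ k) ≡⟨ expand (+ T) (+ k) (+ d) ⟩
  (+ T) ℤ.* ((+ d) ℤ.* (+ d))                                   ≡⟨ cong ((+ T) ℤ.*_) (ℤ.pos-* d d) ⟨
  (+ T) ℤ.* + (d * d)                                           ≡⟨ ℤ.pos-* T (d * d) ⟨
  + (T * (d * d))                                               ∎)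
  where
  open ≡-Reasoning
  T = suc t
  four-d² : + (4 * (d * d)) ≡ (+ 4) ℤ.* (+ d) ℤ.* (+ d)
  four-d² = trans (ℤ.pos-* 4 (d * d))
    (trans (cong ((+ 4) ℤ.*_) (ℤ.pos-* d d)) (sym (ℤ.*-assoc (+ 4) (+ d) (+ d))))
  expand : ∀ T k d → ℤ.- T ℤ.* (k ℤ.- d ℤ.* d) ℤ.+ T ℤ.* k ≡ T ℤ.* (d ℤ.* d)
  expand = ℤ.solve-∀

corollary6p10 : (k d : ℕ) → 0 < k → 0 < d
    → ¬ (Σ ℕ λ r → r * r ≡ k)
    → (Σ ℤ λ m → (m ℤ.< + 0) × ((+ 4) ℤ.* (+ d) ℤ.* (+ d) ≡ m ℤ.* ((+ k) ℤ.- (+ d) ℤ.* (+ d))))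
    → ¬ (Σ ℕ λ s → (0 < s) × (k ≡ 5 * (s * s)) × ((d ≡ 3 * s) ⊎ (d ≡ 5 * s)) × (Σ ℕ λ n → (2 * s) ∣ F (2 * n + 1)))
    → ¬ (Σ ℕ λ s → (0 < s) × (k ≡ 2 * (s * s)) × (d ≡ 2 * s) × (Σ ℕ λ n → s ∣ G (2 * n + 1)))
    → ¬ (Σ ℤ λ p → Σ ℤ λ q → p ℤ.* p ℤ.- (+ k) ℤ.* q ℤ.* q ≡ ℤ.- (+ 1))
corollary6p10 k d k>0 d>0 _ (+ _ , ℤ.+<+ () , _) _ _ _
corollary6p10 k d k>0 d>0 _ (ℤ.-[1+ t ] , _ , relation) no-fibonacci no-pell (p , q , pell) =
  [ no-fibonacci , no-pell ]′
    (negative-pell⇒exception (suc t) ℤ.∣ p ∣ ℤ.∣ q ∣ k>0 d>0 z<s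
      (relation-ℤ⇒ℕ k d t relation) (pell-ℤ⇒ℕ k p q pell))
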